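{- For any formulas $\alpha,\beta$ over a finite signature $\Sigma$, $[\![\alpha\vee\beta]\!]_e=\big([\![\alpha]\!]_e\setminus[\![\beta]\!]_c\big)\cup\big([\![\beta]\!]_e\setminus[\![\alpha]\!]_c\big)\cup\big([\![\alpha]\!]_e\cap[\![\beta]\!]_e\big)$.
   Context: $\Sigma$ is a finite set of atoms. Formulas are given by $\alpha ::= \bot \mid p \mid \alpha_1\wedge\alpha_2 \mid \alpha_1\vee\alpha_2 \mid \alpha_1\rightarrow\alpha_2$ with $p\in\Sigma$. A partial interpretation is a map $v:\Sigma\to\{0,1,2\}$; $\mathcal I$ is the set of all of them and $\mathcal I_c$ the set of classical ones (no atom mapped to $1$). The $G_3$ valuation extends $v$ to formulas: $v(\bot)=0$, $v(\alpha\wedge\beta)=\min(v(\alpha),v(\beta))$, $v(\alpha\vee\beta)=\max(v(\alpha),v(\beta))$, $v(\alpha\to\beta)=2$ if $v(\alpha)\le v(\beta)$ and $=v(\beta)$ otherwise; $v$ is a model of $\alpha$ iff $v(\alpha)=2$. The order on $\mathcal I$: $u\le v$ iff for every atom $p$, $u(p)\le v(p)$ and ($u(p)=0$ implies $v(p)=0$). A classical interpretation $v\in\mathcal I_c$ is an equilibrium model of $\alpha$ iff it is a $\le$-minimal model of $\alpha$; $[\![\alpha]\!]_e$ denotes the set of equilibrium models of $\alpha$. For $S\subseteq\mathcal I$: $\overline S=\mathcal I\setminus S$; $S_c=S\cap\mathcal I_c$; $S\downarrow=\{u\in\mathcal I:\exists v\in S,\ v\ge u\}$. The denotation: $[\![\bot]\!]=\emptyset$;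 $[\![p]\!]=\{v\in\mathcal I: v(p)=2\}$; $[\![\alpha\wedge\beta]\!]=[\![\alpha]\!]\cap[\![\beta]\!]$; $[\![\alpha\vee\beta]\!]=[\![\alpha]\!]\cup[\![\beta]\!]$; $[\![\alpha\to\beta]\!]=\big(\overline{[\![\alpha]\!]}\cup[\![\beta]\!]\big)\cap\big(\overline{[\![\alpha]\!]}\cup[\![\beta]\!]\big)_c\downarrow$; and $[\![\alpha]\!]_c=[\![\alpha]\!]\cap\mathcal I_c$. -}

module Defs where

open import Data.Nat using (ℕ)
open import Data.Fin using (Fin)
open import Data.Product using (_×_; Σ; ∃; _,_)
open import Data.Sum using (_⊎_)
open import Relation.Nullary using (¬_)
open import Relation.Binary.PropositionalEquality using (_≡_)
open import Level using (0ℓ)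

-- Truth values of G3: 0, 1, 2
data V3 : Set where
  v0 v1 v2 : V3

data _≤₃_ : V3 → V3 → Set where
  0≤x : ∀ {x} → v0 ≤₃ x
  1≤1 : v1 ≤₃ v1
  1≤2 : v1 ≤₃ v2
  2≤2 : v2 ≤₃ v2

min₃ : V3 → V3 → V3
min₃ v0 _ = v0
min₃ v1 v0 = v0
min₃ v1 _ = v1
min₃ v2 y = y

max₃ : V3 → V3 → V3
max₃ v0 y = y
max₃ v1 v2 = v2
max₃ v1 _ = v1
max₃ v2 _ = v2

-- G3 implication: 2 if x ≤ y, else y
imp₃ : V3 → V3 → V3
imp₃ v0 _ = v2
imp₃ v1 v0 = v0
imp₃ v1 _ = v2
imp₃ v2 y = y

data Formula (n : ℕ) : Set where
  ⊥' : Formula n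
  atom : Fin n → Formula n
  _∧'_ _∨'_ _⇒'_ : Formula n → Formula n → Formula n

Interp : ℕ → Set
Interp n = Fin n → V3

Classical : ∀ {n} → Interp n → Set
Classical v = ∀ p → ¬ (v p ≡ v1)

eval : ∀ {n} → Interp n → Formula n → V3
eval v ⊥' = v0
eval v (atom p) = v p
eval v (a ∧' b) = min₃ (eval v a) (eval v b)
eval v (a ∨' b) = max₃ (eval v a) (eval v b)
eval v (a ⇒' b) = imp₃ (eval v a) (eval v b)

Model : ∀ {n} → Interp n → Formula n → Set
Model v a = eval v a ≡ v2

_⊑_ : ∀ {n} → Interp n → Interp n → Set
u ⊑ v = ∀ p → (u p ≤₃ v p) × (u p ≡ v0 → v p ≡ v0)

ISet : ℕ → Set₁
ISet n = Interp n → Set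

_∩_ _∪_ _∖_ : ∀ {n} → ISet n → ISet n → ISet n
(S ∩ T) v = S v × T v
(S ∪ T) v = S v ⊎ T v
(S ∖ T) v = S v × ¬ T v

∁ : ∀ {n} → ISet n → ISet n
∁ S v = ¬ S v

_c : ∀ {n} → ISet n → ISet n
(S c) v = S v × Classical v

_↓ : ∀ {n} → ISet n → ISet n
(S ↓) u = Σ _ (λ v → S v × (u ⊑ v))

_≐_ : ∀ {n} → ISet n → ISet n → Set
S ≐ T = ∀ v → (S v → T v) × (T v → S v)

⟦_⟧ : ∀ {n} → Formula n → ISet n
⟦ ⊥' ⟧ v = Data.Empty.⊥ where import Data.Empty
⟦ atom p ⟧ v = v p ≡ v2
⟦ a ∧' b ⟧ = ⟦ a ⟧ ∩ ⟦ b ⟧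
⟦ a ∨' b ⟧ = ⟦ a ⟧ ∪ ⟦ b ⟧
⟦ a ⇒' b ⟧ = (∁ ⟦ a ⟧ ∪ ⟦ b ⟧) ∩ (((∁ ⟦ a ⟧ ∪ ⟦ b ⟧) c) ↓)

⟦_⟧c : ∀ {n} → Formula n → ISet n
⟦ a ⟧c = ⟦ a ⟧ c

⟦_⟧e : ∀ {n} → Formula n → ISet n
⟦ a ⟧e v = Classical v × Model v a ×
           (∀ u → Model u a → u ⊑ v → ∀ p → u p ≡ v p)

-- In the here-and-there reading, u ⊑ v with v classical means that v is the "there"
-- world of u, so every G3-model u of φ lies below a classical model v of φ, and on
-- classical interpretations the denotation ⟦ φ ⟧ is just G3-truth. A model of α ∨ β
-- below v is a model of α or of β; hence v is minimal for α ∨ β exactly when it is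
-- minimal for each disjunct that it satisfies, while for a disjunct it falsifies there
-- is nothing to check, since none of its models lie below v.
module Submission where

open import Defs
open import Data.Nat using (ℕ)
open import Data.Product using (_×_; _,_; proj₁; proj₂)
open import Data.Sum using (_⊎_; inj₁; inj₂; [_,_])
import Data.Sum as Sum
open import Data.Empty using (⊥-elim)
open import Function using (_∘_)
open import Function.Bundles using (_⇔_; mk⇔; Equivalence)
open import Relation.Nullary using (¬_; Dec; yes; no)
open import Relation.Binary.PropositionalEquality
  using (_≡_; _≢_; refl; sym; trans; cong; cong₂)

private
  variable
    n : ℕ
    u v : Interp n

open Equivalence

≤₃-refl : ∀ x → x ≤₃ x
≤₃-refl v0 = 0≤x
≤₃-refl v1 = 1≤1
≤₃-refl v2 = 2≤2

⊑-refl : (v : Interp n) → v ⊑ v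
⊑-refl v p = ≤₃-refl (v p) , λ v≡0 → v≡0

_≟v2 : (x : V3) → Dec (x ≡ v2)
v0 ≟v2 = no λ ()
v1 ≟v2 = no λ ()
v2 ≟v2 = yes refl

min₃≡v2⇒ : ∀ x y → min₃ x y ≡ v2 → x ≡ v2 × y ≡ v2
min₃≡v2⇒ v1 v0 ()
min₃≡v2⇒ v1 v1 ()
min₃≡v2⇒ v1 v2 ()
min₃≡v2⇒ v2 v2 refl = refl , refl

max₃≡v2⇒ : ∀ x y → max₃ x y ≡ v2 → x ≡ v2 ⊎ y ≡ v2
max₃≡v2⇒ v0 y eq = inj₂ eq
max₃≡v2⇒ v1 v2 eq = inj₂ eq
max₃≡v2⇒ v2 y eq = inj₁ refl

max₃-v2ʳ : ∀ x → max₃ x v2 ≡ v2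
max₃-v2ʳ v0 = refl
max₃-v2ʳ v1 = refl
max₃-v2ʳ v2 = refl

imp₃≡v2⇒ : ∀ x y → imp₃ x y ≡ v2 → x ≢ v2 ⊎ y ≡ v2
imp₃≡v2⇒ v0 y eq = inj₁ λ ()
imp₃≡v2⇒ v1 y eq = inj₁ λ ()
imp₃≡v2⇒ v2 y eq = inj₂ eq

imp₃≡v2⇐ : ∀ x y → x ≢ v1 → x ≢ v2 ⊎ y ≡ v2 → imp₃ x y ≡ v2
imp₃≡v2⇐ v0 y x≢1 _ = refl
imp₃≡v2⇐ v1 y x≢1 _ = ⊥-elim (x≢1 refl)
imp₃≡v2⇐ v2 y x≢1 (inj₁ x≢2) = ⊥-elim (x≢2 refl)
imp₃≡v2⇐ v2 y x≢1 (inj₂ y≡2) = y≡2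

-- The truth value at the "there" world: "true only there" (1) becomes true (2).
there : V3 → V3
there v1 = v2
there x = x

there-min : ∀ x y → there (min₃ x y) ≡ min₃ (there x) (there y)
there-min v0 y = refl
there-min v1 v0 = refl
there-min v1 v1 = refl
there-min v1 v2 = refl
there-min v2 y = refl

there-max : ∀ x y → there (max₃ x y) ≡ max₃ (there x) (there y)
there-max v0 y = refl
there-max v1 v0 = refl
there-max v1 v1 = refl
there-max v1 v2 = refl
there-max v2 y = refl

there-imp : ∀ x y → there (imp₃ x y) ≡ imp₃ (there x) (there y)
there-imp v0 y = refl
there-imp v1 v0 = refl
there-imp v1 v1 = refl
there-imp v1 v2 = refl
there-imp v2 v0 = refl
there-imp v2 v1 = refl
there-imp v2 v2 = refl

there-above : ∀ {x y} → x ≤₃ y → (x ≡ v0 → y ≡ v0) → y ≢ v1 → y ≡ there x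
there-above {v0} _ x≡0⇒y≡0 _ = x≡0⇒y≡0 refl
there-above 1≤1 _ y≢1 = ⊥-elim (y≢1 refl)
there-above 1≤2 _ _ = refl
there-above 2≤2 _ _ = refl

eval-there : u ⊑ v → Classical v → ∀ φ → eval v φ ≡ there (eval u φ)
eval-there u⊑v cl ⊥' = refl
eval-there u⊑v cl (atom p) = there-above (proj₁ (u⊑v p)) (proj₂ (u⊑v p)) (cl p)
eval-there {u = u} u⊑v cl (a ∧' b) =
  trans (cong₂ min₃ (eval-there u⊑v cl a) (eval-there u⊑v cl b))
        (sym (there-min (eval u a) (eval u b)))
eval-there {u = u} u⊑v cl (a ∨' b) =
  trans (cong₂ max₃ (eval-there u⊑v cl a) (eval-there u⊑v cl b))
        (sym (there-max (eval u a) (eval u b)))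
eval-there {u = u} u⊑v cl (a ⇒' b) =
  trans (cong₂ imp₃ (eval-there u⊑v cl a) (eval-there u⊑v cl b))
        (sym (there-imp (eval u a) (eval u b)))

model-persistent : ∀ φ → u ⊑ v → Classical v → Model u φ → Model v φ
model-persistent φ u⊑v cl u⊨φ = trans (eval-there u⊑v cl φ) (cong there u⊨φ)

eval-classical-≢v1 : Classical v → ∀ φ → eval v φ ≢ v1
eval-classical-≢v1 {v = v} cl φ eq
  with trans (sym eq) (trans (eval-there (⊑-refl v) cl φ) (cong there eq))
... | ()

Model-∨ˡ : ∀ α β → Model u α → Model u (α ∨' β)
Model-∨ˡ α β u⊨α = cong (λ x → max₃ x _) u⊨α

Model-∨ʳ : ∀ α β → Model u β → Model u (α ∨' β)
Model-∨ʳ {u = u} α β u⊨β = trans (cong (max₃ (eval u α)) u⊨β) (max₃-v2ʳ (eval u α))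

Model-∨⁻ : ∀ α β → Model u (α ∨' β) → Model u α ⊎ Model u β
Model-∨⁻ {u = u} α β = max₃≡v2⇒ (eval u α) (eval u β)

⟦⟧⇔Model : Classical v → ∀ φ → ⟦ φ ⟧ v ⇔ Model v φ
⟦⟧⇔Model cl ⊥' = mk⇔ (λ ()) (λ ())
⟦⟧⇔Model cl (atom p) = mk⇔ (λ eq → eq) (λ eq → eq)
⟦⟧⇔Model {v = v} cl (a ∧' b) = mk⇔
  (λ (da , db) → cong₂ min₃ (to (⟦⟧⇔Model cl a) da) (to (⟦⟧⇔Model cl b) db))
  (λ eq → let ea , eb = min₃≡v2⇒ (eval v a) (eval v b) eq
          in from (⟦⟧⇔Model cl a) ea , from (⟦⟧⇔Model cl b) eb)
⟦⟧⇔Model cl (a ∨' b) = mk⇔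
  [ Model-∨ˡ a b ∘ to (⟦⟧⇔Model cl a) , Model-∨ʳ a b ∘ to (⟦⟧⇔Model cl b) ]
  (Sum.map (from (⟦⟧⇔Model cl a)) (from (⟦⟧⇔Model cl b)) ∘ Model-∨⁻ a b)
⟦⟧⇔Model {v = v} cl (a ⇒' b) = mk⇔
  (λ (holds , _) → imp₃≡v2⇐ (eval v a) (eval v b) (eval-classical-≢v1 cl a)
    (Sum.map (_∘ from (⟦⟧⇔Model cl a)) (to (⟦⟧⇔Model cl b)) holds))
  -- For classical v the ↓-conjunct of the denotation is witnessed by v itself.
  (λ eq → let holds = Sum.map (_∘ to (⟦⟧⇔Model cl a)) (from (⟦⟧⇔Model cl b))
                              (imp₃≡v2⇒ (eval v a) (eval v b) eq)
          in holds , v , (holds , cl) , ⊑-refl v)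

Minimal : Formula n → Interp n → Set
Minimal φ v = ∀ u → Model u φ → u ⊑ v → ∀ p → u p ≡ v p

minimal-∨ : ∀ α β → Minimal α v → Minimal β v → Minimal (α ∨' β) v
minimal-∨ α β min-α min-β u u⊨α∨β u⊑v with Model-∨⁻ α β u⊨α∨β
... | inj₁ u⊨α = min-α u u⊨α u⊑v
... | inj₂ u⊨β = min-β u u⊨β u⊑v

minimal-∨⇒ˡ : ∀ α β → Minimal (α ∨' β) v → Minimal α v
minimal-∨⇒ˡ α β min u = min u ∘ Model-∨ˡ α β

minimal-∨⇒ʳ : ∀ α β → Minimal (α ∨' β) v → Minimal β v
minimal-∨⇒ʳ α β min u = min u ∘ Model-∨ʳ α β

minimal-non-model : ∀ φ → Classical v → ¬ Model v φ → Minimal φ v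
minimal-non-model φ cl v⊭φ u u⊨φ u⊑v = ⊥-elim (v⊭φ (model-persistent φ u⊑v cl u⊨φ))

¬⟦⟧c⇒¬Model : Classical v → ∀ φ → ¬ ⟦ φ ⟧c v → ¬ Model v φ
¬⟦⟧c⇒¬Model cl φ ¬dc v⊨φ = ¬dc (from (⟦⟧⇔Model cl φ) v⊨φ , cl)

¬Model⇒¬⟦⟧c : ∀ φ → ¬ Model v φ → ¬ ⟦ φ ⟧c v
¬Model⇒¬⟦⟧c φ v⊭φ (dφ , cl) = v⊭φ (to (⟦⟧⇔Model cl φ) dφ)

proposition6 : ∀ {n : ℕ} (α β : Formula n) →
    ⟦ α ∨' β ⟧e ≐ (((⟦ α ⟧e ∖ ⟦ β ⟧c) ∪ (⟦ β ⟧e ∖ ⟦ α ⟧c)) ∪ (⟦ α ⟧e ∩ ⟦ β ⟧e))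
proposition6 α β v = split , join
  where
  Decomposition : Set
  Decomposition =
    (((⟦ α ⟧e ∖ ⟦ β ⟧c) ∪ (⟦ β ⟧e ∖ ⟦ α ⟧c)) ∪ (⟦ α ⟧e ∩ ⟦ β ⟧e)) v
  split : ⟦ α ∨' β ⟧e v → Decomposition
  split (cl , v⊨α∨β , min) with eval v α ≟v2 | eval v β ≟v2
  ... | yes v⊨α | yes v⊨β =
    inj₂ ((cl , v⊨α , minimal-∨⇒ˡ α β min) , (cl , v⊨β , minimal-∨⇒ʳ α β min))
  ... | yes v⊨α | no v⊭β =
    inj₁ (inj₁ ((cl , v⊨α , minimal-∨⇒ˡ α β min) , ¬Model⇒¬⟦⟧c β v⊭β))
  ... | no v⊭α | yes v⊨β =
    inj₁ (inj₂ ((cl , v⊨β , minimal-∨⇒ʳ α β min) , ¬Model⇒¬⟦⟧c α v⊭α))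
  ... | no v⊭α | no v⊭β = ⊥-elim ([ v⊭α , v⊭β ] (Model-∨⁻ α β v⊨α∨β))
  join : Decomposition → ⟦ α ∨' β ⟧e v
  join (inj₁ (inj₁ ((cl , v⊨α , min-α) , ¬dβ))) =
    cl , Model-∨ˡ α β v⊨α , minimal-∨ α β min-α (minimal-non-model β cl (¬⟦⟧c⇒¬Model cl β ¬dβ))
  join (inj₁ (inj₂ ((cl , v⊨β , min-β) , ¬dα))) =
    cl , Model-∨ʳ α β v⊨β , minimal-∨ α β (minimal-non-model α cl (¬⟦⟧c⇒¬Model cl α ¬dα)) min-β
  join (inj₂ ((cl , v⊨α , min-α) , (_ , _ , min-β))) =
    cl , Model-∨ˡ α β v⊨α , minimal-∨ α β min-α min-β
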